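{- Let $n\ge 1$ and consider the poset $[\mathbf{n}]^*$ of words over the alphabet $[\mathbf{n}]=\{\mathbf{1},\ldots,\mathbf{n}\}$ under composition order. For $\mathbf{k}\in[\mathbf{n}]$ define $$z(\mathbf{k})=[\mathbf{k},\mathbf{n}]\cdot[\mathbf{k}-\mathbf{1}]^*,$$ $$m(\mathbf{1})=\mathbf{1}-\mathbf{2}^+(\varepsilon-\mathbf{1}),\qquad m(\mathbf{k})=\big(\mathbf{k}^+-(\mathbf{k}+\mathbf{1})^+\big)(\varepsilon-\mathbf{1})\ \text{ for } k\ge 2,$$ and extend $z$ and $m$ multiplicatively to all of $[\mathbf{n}]^*$. Then for every $u\in[\mathbf{n}]^*$, $$Z(u)=[\mathbf{n}]^*\, z(u)\qquad\text{and}\qquad M(u)=(\varepsilon-\mathbf{1})\, m(u).$$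
   Context: Composition order: for words $u,w$ over the positive integers $\mathbb{P}$, $u\le w$ iff there are indices $i_1<\cdots<i_l$ with $l=\ell(u)$ (the length of $u$) and $u(j)\le w(i_j)$ for $1\le j\le l$. $[\mathbf{n}]^*$ is the subposet of words all of whose letters lie in $\{1,\ldots,n\}$; integers viewed as letters are written in boldface. $\varepsilon$ is the empty word. $\mathbb{Z}\langle\langle[\mathbf{n}]\rangle\rangle$ is the algebra of formal power series in noncommuting variables $\mathbf{1},\ldots,\mathbf{n}$ with integer coefficients. A set $S$ of words also denotes the series $\sum_{w\in S}w$; so $[\mathbf{k},\mathbf{n}]=\mathbf{k}+(\mathbf{k}+\mathbf{1})+\cdots+\mathbf{n}$, $[\mathbf{k}-\mathbf{1}]=\mathbf{1}+\cdots+(\mathbf{k}-\mathbf{1})$ (the zero series when $k=1$), and when $k=n$ the symbol $\mathbf{k}+\mathbf{1}$ (in particular $\mathbf{2}$ when $n=1$) denotes the zero series. For a series $f$ with zero constant term, $f^*=\varepsilon+f+f^2+\cdots=(\varepsilon-f)^{ -1}$ and $f^+=f^*-\varepsilon$. A map $F:[\mathbf{n}]^*\to\mathbb{Z}\langle\langle[\mathbf{n}]\rangle\rangle$ is multiplicative if $F(u)=F(u(1))F(u(2))\cdots F(u(l))$ for $u=u(1)\cdots u(l)$ (with $F(\varepsilon)=\varepsilon$). $Z(u)=\sum_{w\ge u} w$ (sum over $w\in[\mathbf{n}]^*$). Embeddings: an expansion of $u$ is a word $\eta$ over $\mathbb{P}\cup\{0\}$ whose restriction to its support $\{i:\eta(i)\ne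 0\}$ is $u$. An embedding of $u$ into $w$ is an expansion $\eta_u$ with $\ell(\eta_u)=\ell(w)$ and $\eta_u(i)\le w(i)$ for all $i$ (with $0$ below every positive integer). A run of $\mathbf{k}$'s in $w$ is a maximal interval of indices $[r,t]$ with $w(r)=\cdots=w(t)=\mathbf{k}$. An embedding is normal if (1) for each $i$, $\eta_u(i)\in\{w(i),w(i)-1,0\}$; and (2) for every run $[r,t]$ of $\mathbf{k}$'s in $w$: if $k=1$ then $(r,t]\subseteq\operatorname{Supp}\eta_u$, and if $k\ge 2$ then $r\in\operatorname{Supp}\eta_u$. The defect of a normal embedding is $d(\eta_u)=\#\{i:\eta_u(i)=w(i)-1\}$. $M(u)=\sum_{w\ge u}\big(\sum_{\eta_u}(-1)^{d(\eta_u)}\big)w$, the inner sum over all normal embeddings $\eta_u$ of $u$ into $w$, the outer over $w\in[\mathbf{n}]^*$. -}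

module Defs where

open import Data.Nat as ℕ using (ℕ; zero; suc; _≤_; _≤?_; _∸_)
open import Data.Integer as ℤ using (ℤ; 0ℤ; 1ℤ; -1ℤ)
open import Data.Fin using (Fin; toℕ)
open import Data.List using (List; []; _∷_; map; length; concatMap; upTo; filterᵇ; foldr)
open import Data.List.Properties using (≡-dec)
open import Data.Bool using (Bool; true; false; if_then_else_; _∧_; not)
open import Data.Maybe using (Maybe; just; nothing)
open import Relation.Nullary using (Dec; yes; no; does)

-- Words over the alphabet [n] = {1,…,n}.  A letter is an element a of
-- Fin n; the positive integer it stands for is  val a = toℕ a + 1.

Word : ℕ → Set
Word n = List (Fin n)

val : ∀ {n} → Fin n → ℕ
val a = suc (toℕ a)

-- Composition order: u ≼ w iff there are indices i₁<⋯<iₗ (l = ℓ(u))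
-- with u(j) ≤ w(iⱼ).  Inductively: an order-preserving choice of
-- positions of w dominating the letters of u.

data _≼_ {n : ℕ} : Word n → Word n → Set where
  done : ∀ {w} → [] ≼ w
  skip : ∀ {u b w} → u ≼ w → u ≼ (b ∷ w)
  take : ∀ {a u b w} → val a ≤ val b → u ≼ w → (a ∷ u) ≼ (b ∷ w)

_≼?_ : ∀ {n} (u w : Word n) → Dec (u ≼ w)
[] ≼? w = yes done
(a ∷ u) ≼? [] = no λ ()
(a ∷ u) ≼? (b ∷ w) with val a ≤? val b | u ≼? w | (a ∷ u) ≼? w
... | yes p | yes q | _     = yes (take p q)
... | _     | _     | yes r = yes (skip r)
... | no ¬p | _     | no ¬r = no λ { (skip r) → ¬r r ; (take p q) → ¬p p }
... | yes p | no ¬q | no ¬r = no λ { (skip r) → ¬r r ; (take p q) → ¬q q }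

-- Formal power series in the noncommuting variables 1,…,n with integer
-- coefficients: a series is its coefficient function on words.
-- Equality of series is pointwise equality of coefficients.

sumℤ : List ℤ → ℤ
sumℤ = foldr ℤ._+_ 0ℤ

Series : ℕ → Set
Series n = Word n → ℤ

zeroS : ∀ {n} → Series n
zeroS _ = 0ℤ

εS : ∀ {n} → Series n
εS []      = 1ℤ
εS (_ ∷ _) = 0ℤ

infixl 6 _⊕_ _⊖_
infixl 7 _⊙_

_⊕_ : ∀ {n} → Series n → Series n → Series n
(f ⊕ g) w = f w ℤ.+ g w

_⊖_ : ∀ {n} → Series n → Series n → Series n
(f ⊖ g) w = f w ℤ.- g w

-- Cauchy product: (f·g)(w) = Σ_{xy = w} f(x) g(y).
-- Recursion: the split with x = ε, plus the splits with x = a x'.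
_⊙_ : ∀ {n} → Series n → Series n → Series n
(f ⊙ g) []      = f [] ℤ.* g []
(f ⊙ g) (a ∷ w) = f [] ℤ.* g (a ∷ w) ℤ.+ ((λ x → f (a ∷ x)) ⊙ g) w

pow : ∀ {n} → Series n → ℕ → Series n
pow f zero    = εS
pow f (suc k) = f ⊙ pow f k

-- f* = ε + f + f² + ⋯ for f with zero constant term.  Since then fᵏ has
-- no words of length < k, the coefficient of w is Σ_{k ≤ ℓ(w)} fᵏ(w).
-- (Only ever applied below to series with zero constant term.)
star : ∀ {n} → Series n → Series n
star f w = sumℤ (map (λ k → pow f k w) (upTo (suc (length w))))

plus : ∀ {n} → Series n → Series n
plus f = star f ⊖ εS

-- In particular the single letter k is  interval k k, which is the
-- zero series when k = n+1, and [k-1] = interval 1 (k-1) is zero for k=1.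
interval : ∀ {n} → ℕ → ℕ → Series n
interval lo hi []          = 0ℤ
interval lo hi (a ∷ _ ∷ _) = 0ℤ
interval lo hi (a ∷ [])    =
  if does (lo ≤? val a) ∧ does (val a ≤? hi) then 1ℤ else 0ℤ

lit : ∀ {n} → ℕ → Series n
lit k = interval k k

allWords : ∀ n → Series n
allWords n = star (interval 1 n)

zL : ∀ {n} → Fin n → Series n
zL {n} a = interval (val a) n ⊙ star (interval 1 (val a ∸ 1))

mL : ∀ {n} → Fin n → Series n
mL {n} a with val a
... | 1         = lit 1 ⊖ plus (lit 2) ⊙ (εS ⊖ lit 1)
... | k@(suc (suc _)) = (plus (lit k) ⊖ plus (lit (suc k))) ⊙ (εS ⊖ lit 1)
... | 0         = zeroS  -- impossible: val a ≥ 1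

multiplicative : ∀ {n} → (Fin n → Series n) → Word n → Series n
multiplicative F []      = εS
multiplicative F (a ∷ u) = F a ⊙ multiplicative F u

z : ∀ {n} → Word n → Series n
z = multiplicative zL

m : ∀ {n} → Word n → Series n
m = multiplicative mL

Z : ∀ {n} → Word n → Series n
Z u w = if does (u ≼? w) then 1ℤ else 0ℤ

-- Embeddings.  An expansion is a word η over ℕ = P ∪ {0}; w is given by
-- its list of letter values.

_==_ : ℕ → ℕ → Bool
x == y = does (x ℕ.≟ y)

bounded : List ℕ → List (List ℕ)
bounded []      = [] ∷ []
bounded (b ∷ w) = concatMap (λ x → map (x ∷_) (bounded w)) (upTo (suc b))

support : List ℕ → List ℕ
support = filterᵇ (λ x → not (x == 0))

isExpansion : List ℕ → List ℕ → Bool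
isExpansion u η = does (≡-dec ℕ._≟_ (support η) u)

cond1 : List ℕ → List ℕ → Bool
cond1 (b ∷ w) (e ∷ η) = ((e == b) Data.Bool.∨ (e == (b ∸ 1)) Data.Bool.∨ (e == 0)) ∧ cond1 w η
cond1 [] [] = true
cond1 _  _  = false

-- condition (2), scanning w left to right with the previous letter:
-- position i lies in a run [r,t] of k's; i = r iff i is first or
-- w(i-1) ≠ w(i), and i ∈ (r,t] iff w(i-1) = w(i).
--  k = 1: every i ∈ (r,t] must be in Supp η;
--  k ≥ 2: r must be in Supp η.
cond2 : Maybe ℕ → List ℕ → List ℕ → Bool
cond2 prev (b ∷ w) (e ∷ η) = here ∧ cond2 (just b) w η
  where
  sameAs : Maybe ℕ → Bool
  sameAs nothing  = false
  sameAs (just p) = p == b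
  sameAsPrev : Bool
  sameAsPrev = sameAs prev
  here : Bool
  here = if b == 1
         then (if sameAsPrev then not (e == 0) else true)
         else (if sameAsPrev then true else not (e == 0))
cond2 _ [] [] = true
cond2 _ _  _  = false

isNormalEmbedding : List ℕ → List ℕ → List ℕ → Bool
isNormalEmbedding u w η = isExpansion u η ∧ cond1 w η ∧ cond2 nothing w η

defect : List ℕ → List ℕ → ℕ
defect (b ∷ w) (e ∷ η) = (if e == (b ∸ 1) then 1 else 0) ℕ.+ defect w η
defect _ _ = 0

M : ∀ {n} → Word n → Series n
M u w =
  if does (u ≼? w)
  then sumℤ (map (λ η → -1ℤ ℤ.^ defect (map val w) η)
                (filterᵇ (isNormalEmbedding (map val u) (map val w))
                         (bounded (map val w))))
  else 0ℤ

module Submission where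

-- Both identities are proved by splitting off the first letter of w.  Write
-- ∂ b f for the series w ↦ f (b w); then (f ⊙ g) (b w) = f ε · g (b w) + (∂ b f ⊙ g) w.
--
-- Z: since ∂ b [n]* = [n]*, the coefficient of w in [n]* z(u) is the sum of the
-- coefficients of z(u) over the suffixes of w, so it suffices that
-- z(u) (b y) = Z(u) (b y) − Z(u) (y).  By induction on u this reduces to the fact
-- that [a−1]* z(v) is the indicator of the words y with v ≤ y but a v ≰ y.
--
-- M: a normal embedding is read off position by position.  A position outside the
-- support (a gap) contributes a sign that depends only on its letter and on the
-- letter p preceding it in w, and these contributions are generated by the series
-- gaps p below; a position carrying the next letter a of u contributes
-- letterWeight a b.  Hence the signed count of normal embeddings satisfies the same
-- first-letter recursion as gaps p ⊙ m(u), because ∂ b (gaps p) and ∂ b m(a) are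
-- both multiples of gaps (just b).  At the start of w, gaps nothing = ε − 1.

open import Defs
open import Data.Bool using (Bool; true; false; if_then_else_; _∧_; _∨_; not)
open import Data.Bool.Properties using (∧-identityʳ; ∨-zeroʳ; if-eta; if-cong₂)
open import Data.Empty using (⊥-elim)
open import Data.Fin as Fin using (Fin; toℕ)
open import Data.Fin.Properties using (toℕ<n)
open import Data.Integer using (ℤ; 0ℤ; 1ℤ; -1ℤ; _+_; _*_; -_; _-_; _^_)
import Data.Integer.Properties as ℤ
open import Data.Integer.Tactic.RingSolver using (solve-∀)
open import Data.List using (List; []; _∷_; length; map; applyUpTo; upTo; concatMap; filterᵇ; _++_)
open import Data.List.Properties using (map-∘; map-cong; map-++)
open import Data.Maybe using (Maybe; just; nothing)
open import Data.Nat as ℕ using (ℕ; zero; suc; _≤_; _<_; _∸_; _≤?_; z≤n; s≤s)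
import Data.Nat.Properties as ℕ
open import Data.Product using (_×_; _,_)
open import Function using (_∘_)
open import Relation.Nullary using (Dec; yes; no; does; ¬_)
open import Relation.Nullary.Decidable using (dec-true; dec-false)
open import Relation.Binary.PropositionalEquality
  using (_≡_; refl; sym; trans; cong; cong₂; module ≡-Reasoning)

𝟙 : Bool → ℤ
𝟙 b = if b then 1ℤ else 0ℤ

𝟙-not : ∀ b → 𝟙 (not b) ≡ 1ℤ - 𝟙 b
𝟙-not true  = refl
𝟙-not false = refl

𝟙-∧ : ∀ b c → 𝟙 (b ∧ c) ≡ 𝟙 b * 𝟙 c
𝟙-∧ true  c = sym (ℤ.*-identityˡ (𝟙 c))
𝟙-∧ false c = refl

𝟙-∧-∧ : ∀ x y z → 𝟙 (x ∧ y ∧ z) ≡ 𝟙 x * 𝟙 y * 𝟙 z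
𝟙-∧-∧ false y     z = refl
𝟙-∧-∧ true  false z = refl
𝟙-∧-∧ true  true  z = sym (ℤ.*-identityˡ (𝟙 z))

𝟙-==-subst : ∀ x y (F : ℕ → ℤ) → 𝟙 (x == y) * F x ≡ 𝟙 (x == y) * F y
𝟙-==-subst x y F = decide (x ℕ.≟ y)
  where
  decide : (x≟y : Dec (x ≡ y)) → 𝟙 (does x≟y) * F x ≡ 𝟙 (does x≟y) * F y
  decide (yes refl) = refl
  decide (no _)     = refl

Σ< : ℕ → (ℕ → ℤ) → ℤ
Σ< N h = sumℤ (applyUpTo h N)

Σ<-cong : ∀ N {h h′ : ℕ → ℤ} → (∀ k → h k ≡ h′ k) → Σ< N h ≡ Σ< N h′
Σ<-cong zero    eq = refl
Σ<-cong (suc N) eq = cong₂ _+_ (eq 0) (Σ<-cong N (eq ∘ suc))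

Σ<-vanish : ∀ N {h : ℕ → ℤ} → (∀ k → h k ≡ 0ℤ) → Σ< N h ≡ 0ℤ
Σ<-vanish zero    eq = refl
Σ<-vanish (suc N) eq = cong₂ _+_ (eq 0) (Σ<-vanish N (eq ∘ suc))

Σ<-extend : ∀ {N N′} {h : ℕ → ℤ} → N ≤ N′ → (∀ k → N ≤ k → h k ≡ 0ℤ) → Σ< N′ h ≡ Σ< N h
Σ<-extend {N′ = N′} z≤n        eq = Σ<-vanish N′ (λ k → eq k z≤n)
Σ<-extend {h = h}   (s≤s N≤N′) eq = cong (h 0 +_) (Σ<-extend N≤N′ (λ k → eq (suc k) ∘ s≤s))

Σ<-pick : ∀ N a (h : ℕ → ℤ) → (N ≤ a → h a ≡ 0ℤ) → Σ< N (λ k → 𝟙 (k == a) * h k) ≡ h a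
Σ<-pick zero    a       h eq = sym (eq z≤n)
Σ<-pick (suc N) zero    h eq = begin
  1ℤ * h 0 + Σ< N (λ k → 𝟙 (suc k == 0) * h (suc k))
    ≡⟨ cong₂ _+_ (ℤ.*-identityˡ (h 0)) (Σ<-vanish N (λ _ → refl)) ⟩
  h 0 + 0ℤ
    ≡⟨ ℤ.+-identityʳ (h 0) ⟩
  h 0 ∎
  where open ≡-Reasoning
Σ<-pick (suc N) (suc a) h eq = trans (ℤ.+-identityˡ _) (Σ<-pick N a (h ∘ suc) (eq ∘ s≤s))

sumℤ-++ : ∀ xs ys → sumℤ (xs ++ ys) ≡ sumℤ xs + sumℤ ys
sumℤ-++ []       ys = sym (ℤ.+-identityˡ (sumℤ ys))
sumℤ-++ (x ∷ xs) ys = trans (cong (x +_) (sumℤ-++ xs ys)) (sym (ℤ.+-assoc x (sumℤ xs) (sumℤ ys)))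

module _ {A : Set} where

  sumℤ-map-cong : ∀ {h h′ : A → ℤ} → (∀ x → h x ≡ h′ x) → ∀ xs →
                  sumℤ (map h xs) ≡ sumℤ (map h′ xs)
  sumℤ-map-cong eq xs = cong sumℤ (map-cong eq xs)

  sumℤ-map-vanish : ∀ {h : A → ℤ} → (∀ x → h x ≡ 0ℤ) → ∀ xs → sumℤ (map h xs) ≡ 0ℤ
  sumℤ-map-vanish eq []       = refl
  sumℤ-map-vanish eq (x ∷ xs) = cong₂ _+_ (eq x) (sumℤ-map-vanish eq xs)

  sumℤ-map-*ˡ : ∀ c (h : A → ℤ) xs → sumℤ (map (λ x → c * h x) xs) ≡ c * sumℤ (map h xs)
  sumℤ-map-*ˡ c h []       = sym (ℤ.*-zeroʳ c)
  sumℤ-map-*ˡ c h (x ∷ xs) =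
    trans (cong (c * h x +_) (sumℤ-map-*ˡ c h xs)) (sym (ℤ.*-distribˡ-+ c (h x) (sumℤ (map h xs))))

  sumℤ-map-filterᵇ : ∀ (P : A → Bool) (h : A → ℤ) xs →
    sumℤ (map h (filterᵇ P xs)) ≡ sumℤ (map (λ x → 𝟙 (P x) * h x) xs)
  sumℤ-map-filterᵇ P h []       = refl
  sumℤ-map-filterᵇ P h (x ∷ xs) with P x
  ... | true  = cong₂ _+_ (sym (ℤ.*-identityˡ (h x))) (sumℤ-map-filterᵇ P h xs)
  ... | false = trans (sumℤ-map-filterᵇ P h xs) (sym (ℤ.+-identityˡ _))

  sumℤ-map-concatMap : ∀ {B : Set} (h : A → ℤ) (f : B → List A) ys →
    sumℤ (map h (concatMap f ys)) ≡ sumℤ (map (λ y → sumℤ (map h (f y))) ys)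
  sumℤ-map-concatMap h f []       = refl
  sumℤ-map-concatMap h f (y ∷ ys) = begin
    sumℤ (map h (f y ++ concatMap f ys))
      ≡⟨ cong sumℤ (map-++ h (f y) (concatMap f ys)) ⟩
    sumℤ (map h (f y) ++ map h (concatMap f ys))
      ≡⟨ sumℤ-++ (map h (f y)) _ ⟩
    sumℤ (map h (f y)) + sumℤ (map h (concatMap f ys))
      ≡⟨ cong (sumℤ (map h (f y)) +_) (sumℤ-map-concatMap h f ys) ⟩
    sumℤ (map h (f y)) + sumℤ (map (λ y → sumℤ (map h (f y))) ys) ∎
    where open ≡-Reasoning

  sumℤ-map-applyUpTo : ∀ (h : A → ℤ) (g : ℕ → A) N → sumℤ (map h (applyUpTo g N)) ≡ Σ< N (h ∘ g)
  sumℤ-map-applyUpTo h g zero    = refl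
  sumℤ-map-applyUpTo h g (suc N) = cong (h (g 0) +_) (sumℤ-map-applyUpTo h (g ∘ suc) N)

module _ {n : ℕ} where

  infix 4 _≈_
  _≈_ : Series n → Series n → Set
  f ≈ g = ∀ w → f w ≡ g w

  ∂ : Fin n → Series n → Series n
  ∂ a f w = f (a ∷ w)

  infixr 8 _·_
  _·_ : ℤ → Series n → Series n
  (c · f) w = c * f w

  ⊙-congˡ : ∀ {f f′ : Series n} (g : Series n) → f ≈ f′ → f ⊙ g ≈ f′ ⊙ g
  ⊙-congˡ         g eq []      = cong (_* g []) (eq [])
  ⊙-congˡ {f} {f′} g eq (a ∷ w) =
    cong₂ _+_ (cong (_* g (a ∷ w)) (eq [])) (⊙-congˡ {∂ a f} {∂ a f′} g (eq ∘ (a ∷_)) w)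

  ⊙-congʳ-shorter : ∀ (f : Series n) {g g′ : Series n} w →
    (∀ y → length y ≤ length w → g y ≡ g′ y) → (f ⊙ g) w ≡ (f ⊙ g′) w
  ⊙-congʳ-shorter f []      eq = cong (f [] *_) (eq [] z≤n)
  ⊙-congʳ-shorter f (a ∷ w) eq = cong₂ _+_ (cong (f [] *_) (eq (a ∷ w) ℕ.≤-refl))
    (⊙-congʳ-shorter (∂ a f) w (λ y y≤w → eq y (ℕ.m≤n⇒m≤1+n y≤w)))

  ⊙-zeroˡ : ∀ (g : Series n) → zeroS ⊙ g ≈ zeroS
  ⊙-zeroˡ g []      = refl
  ⊙-zeroˡ g (a ∷ w) = trans (ℤ.+-identityˡ _) (⊙-zeroˡ g w)

  ⊙-zeroʳ : ∀ (f : Series n) → f ⊙ zeroS ≈ zeroS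
  ⊙-zeroʳ f []      = ℤ.*-zeroʳ (f [])
  ⊙-zeroʳ f (a ∷ w) = cong₂ _+_ (ℤ.*-zeroʳ (f [])) (⊙-zeroʳ (∂ a f) w)

  ⊙-identityˡ : ∀ (g : Series n) → εS ⊙ g ≈ g
  ⊙-identityˡ g []      = ℤ.*-identityˡ (g [])
  ⊙-identityˡ g (a ∷ w) = begin
    1ℤ * g (a ∷ w) + (zeroS ⊙ g) w  ≡⟨ cong₂ _+_ (ℤ.*-identityˡ (g (a ∷ w))) (⊙-zeroˡ g w) ⟩
    g (a ∷ w) + 0ℤ                  ≡⟨ ℤ.+-identityʳ (g (a ∷ w)) ⟩
    g (a ∷ w)                       ∎
    where open ≡-Reasoning

  ⊙-·ˡ : ∀ c (f g : Series n) → (c · f) ⊙ g ≈ c · (f ⊙ g)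
  ⊙-·ˡ c f g []      = ℤ.*-assoc c (f []) (g [])
  ⊙-·ˡ c f g (a ∷ w) = trans (cong (c * f [] * g (a ∷ w) +_) (⊙-·ˡ c (∂ a f) g w))
                             (distrib c (f []) (g (a ∷ w)) ((∂ a f ⊙ g) w))
    where
    distrib : ∀ c x y z → c * x * y + c * z ≡ c * (x * y + z)
    distrib = solve-∀

  ⊙-distribʳ-⊖ : ∀ (f g h : Series n) → (f ⊖ g) ⊙ h ≈ f ⊙ h ⊖ g ⊙ h
  ⊙-distribʳ-⊖ f g h []      = distrib (f []) (g []) (h [])
    where
    distrib : ∀ x y z → (x - y) * z ≡ x * z - y * z
    distrib = solve-∀
  ⊙-distribʳ-⊖ f g h (a ∷ w) =
    trans (cong ((f [] - g []) * h (a ∷ w) +_) (⊙-distribʳ-⊖ (∂ a f) (∂ a g) h w))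
          (distrib (f []) (g []) (h (a ∷ w)) ((∂ a f ⊙ h) w) ((∂ a g ⊙ h) w))
    where
    distrib : ∀ x y z s t → (x - y) * z + (s - t) ≡ (x * z + s) - (y * z + t)
    distrib = solve-∀

  ⊙-distribˡ-⊕ : ∀ (f g h : Series n) → f ⊙ (g ⊕ h) ≈ f ⊙ g ⊕ f ⊙ h
  ⊙-distribˡ-⊕ f g h []      = ℤ.*-distribˡ-+ (f []) (g []) (h [])
  ⊙-distribˡ-⊕ f g h (a ∷ w) =
    trans (cong (f [] * (g (a ∷ w) + h (a ∷ w)) +_) (⊙-distribˡ-⊕ (∂ a f) g h w))
          (distrib (f []) (g (a ∷ w)) (h (a ∷ w)) ((∂ a f ⊙ g) w) ((∂ a f ⊙ h) w))
    where
    distrib : ∀ x y z s t → x * (y + z) + (s + t) ≡ (x * y + s) + (x * z + t)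
    distrib = solve-∀

  ⊙-distribˡ-Σ< : ∀ N (f : Series n) (g : ℕ → Series n) →
    f ⊙ (λ y → Σ< N (λ k → g k y)) ≈ (λ w → Σ< N (λ k → (f ⊙ g k) w))
  ⊙-distribˡ-Σ< zero    f g w = ⊙-zeroʳ f w
  ⊙-distribˡ-Σ< (suc N) f g w =
    trans (⊙-distribˡ-⊕ f (g 0) (λ y → Σ< N (λ k → g (suc k) y)) w)
          (cong ((f ⊙ g 0) w +_) (⊙-distribˡ-Σ< N f (g ∘ suc) w))

  ∂-⊙-proper : ∀ (f g h : Series n) a c → f [] ≡ 0ℤ → ∂ a f ≈ c · h → ∂ a (f ⊙ g) ≈ c · (h ⊙ g)
  ∂-⊙-proper f g h a c f[]≡0 ∂f≈ch w = begin
    f [] * g (a ∷ w) + (∂ a f ⊙ g) w  ≡⟨ cong (λ x → x * g (a ∷ w) + (∂ a f ⊙ g) w) f[]≡0 ⟩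
    0ℤ + (∂ a f ⊙ g) w                ≡⟨ ℤ.+-identityˡ _ ⟩
    (∂ a f ⊙ g) w                     ≡⟨ ⊙-congˡ g ∂f≈ch w ⟩
    ((c · h) ⊙ g) w                   ≡⟨ ⊙-·ˡ c h g w ⟩
    c * (h ⊙ g) w                     ∎
    where open ≡-Reasoning

  pow-vanish : ∀ (f : Series n) → f [] ≡ 0ℤ → ∀ k y → length y < k → pow f k y ≡ 0ℤ
  pow-vanish f f[]≡0 (suc k) []      _         = cong (_* pow f k []) f[]≡0
  pow-vanish f f[]≡0 (suc k) (a ∷ y) (s≤s y<k) = cong₂ _+_ (cong (_* pow f k (a ∷ y)) f[]≡0)
    (trans (⊙-congʳ-shorter (∂ a f) y
             (λ y′ y′≤y → pow-vanish f f[]≡0 k y′ (ℕ.≤-trans (s≤s y′≤y) y<k)))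
           (⊙-zeroʳ (∂ a f) y))

  star-Σ< : ∀ (f : Series n) w → star f w ≡ Σ< (suc (length w)) (λ k → pow f k w)
  star-Σ< f w = sumℤ-map-applyUpTo (λ k → pow f k w) (λ k → k) (suc (length w))

  ∂-star : ∀ (f : Series n) → f [] ≡ 0ℤ → ∀ a → ∂ a (star f) ≈ ∂ a f ⊙ star f
  ∂-star f f[]≡0 a w = begin
    star f (a ∷ w)                              ≡⟨ star-Σ< f (a ∷ w) ⟩
    0ℤ + Σ< L (λ k → (f ⊙ pow f k) (a ∷ w))     ≡⟨ ℤ.+-identityˡ _ ⟩
    Σ< L (λ k → (f ⊙ pow f k) (a ∷ w))          ≡⟨ Σ<-cong L drop-constant ⟩
    Σ< L (λ k → (∂ a f ⊙ pow f k) w)            ≡⟨ ⊙-distribˡ-Σ< L (∂ a f) (pow f) w ⟨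
    (∂ a f ⊙ (λ y → Σ< L (λ k → pow f k y))) w  ≡⟨ ⊙-congʳ-shorter (∂ a f) w truncate ⟩
    (∂ a f ⊙ star f) w                          ∎
    where
    open ≡-Reasoning
    L = suc (length w)
    drop-constant : ∀ k → (f ⊙ pow f k) (a ∷ w) ≡ (∂ a f ⊙ pow f k) w
    drop-constant k = trans (cong (λ c → c * pow f k (a ∷ w) + (∂ a f ⊙ pow f k) w) f[]≡0)
                            (ℤ.+-identityˡ _)
    truncate : ∀ y → length y ≤ length w → Σ< L (λ k → pow f k y) ≡ star f y
    truncate y y≤w = trans (Σ<-extend (s≤s y≤w) (λ k → pow-vanish f f[]≡0 k y)) (sym (star-Σ< f y))

  ∂-star-· : ∀ (f : Series n) → f [] ≡ 0ℤ → ∀ a c → ∂ a f ≈ c · εS → ∂ a (star f) ≈ c · star f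
  ∂-star-· f f[]≡0 a c ∂f≈cε w = begin
    star f (a ∷ w)         ≡⟨ ∂-star f f[]≡0 a w ⟩
    (∂ a f ⊙ star f) w     ≡⟨ ⊙-congˡ (star f) ∂f≈cε w ⟩
    ((c · εS) ⊙ star f) w  ≡⟨ ⊙-·ˡ c εS (star f) w ⟩
    c * (εS ⊙ star f) w    ≡⟨ cong (c *_) (⊙-identityˡ (star f) w) ⟩
    c * star f w           ∎
    where open ≡-Reasoning

  inInterval : ℕ → ℕ → Fin n → Bool
  inInterval lo hi b = does (lo ≤? val b) ∧ does (val b ≤? hi)

  ∂-interval : ∀ lo hi b → ∂ b (interval lo hi) ≈ 𝟙 (inInterval lo hi b) · εS
  ∂-interval lo hi b []      = sym (ℤ.*-identityʳ (𝟙 (inInterval lo hi b)))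
  ∂-interval lo hi b (_ ∷ _) = sym (ℤ.*-zeroʳ (𝟙 (inInterval lo hi b)))

  ∂-star-interval : ∀ lo hi b →
    ∂ b (star (interval lo hi)) ≈ 𝟙 (inInterval lo hi b) · star (interval lo hi)
  ∂-star-interval lo hi b =
    ∂-star-· (interval lo hi) refl b (𝟙 (inInterval lo hi b)) (∂-interval lo hi b)

≤?-∸1≡not-≤? : ∀ A C → 1 ≤ C → does (C ≤? A ∸ 1) ≡ not (does (A ≤? C))
≤?-∸1≡not-≤? zero    (suc C) _ = refl
≤?-∸1≡not-≤? (suc A) C       _ = decide (suc A ≤? C)
  where
  decide : (A<C? : Dec (A < C)) → does (C ≤? A) ≡ not (does A<C?)
  decide (yes A<C) = dec-false (C ≤? A) (ℕ.<⇒≱ A<C)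
  decide (no  A≮C) = dec-true (C ≤? A) (ℕ.≮⇒≥ A≮C)

module _ {n : ℕ} where

  ≼-tail : ∀ {a : Fin n} {v w} → (a ∷ v) ≼ w → v ≼ w
  ≼-tail (skip r)   = skip (≼-tail r)
  ≼-tail (take _ r) = skip r

  Z-∷-∷ : ∀ (a : Fin n) v c y →
    Z (a ∷ v) (c ∷ y) ≡ Z (a ∷ v) y + 𝟙 (does (val a ≤? val c)) * (Z v y - Z (a ∷ v) y)
  Z-∷-∷ a v c y with val a ≤? val c | v ≼? y | (a ∷ v) ≼? y
  ... | yes a≤c | yes _  | yes _ rewrite dec-true (val a ≤? val c) a≤c = refl
  ... | yes a≤c | yes _  | no _  rewrite dec-true (val a ≤? val c) a≤c = refl
  ... | yes _   | no v⋠y | yes r = ⊥-elim (v⋠y (≼-tail r))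
  ... | yes a≤c | no _   | no _  rewrite dec-true (val a ≤? val c) a≤c = refl
  ... | no a≰c  | _      | yes _ rewrite dec-false (val a ≤? val c) a≰c = refl
  ... | no a≰c  | _      | no _  rewrite dec-false (val a ≤? val c) a≰c = refl

  z-[] : ∀ (v : Word n) → z v [] ≡ Z v []
  z-[] []      = refl
  z-[] (_ ∷ _) = refl

  ∂-allWords : ∀ b → ∂ b (allWords n) ≈ allWords n
  ∂-allWords b w = begin
    allWords n (b ∷ w)
      ≡⟨ ∂-star-interval 1 n b w ⟩
    𝟙 (does (val b ≤? n)) * allWords n w
      ≡⟨ cong (λ t → 𝟙 t * allWords n w) (dec-true (val b ≤? n) (toℕ<n b)) ⟩
    1ℤ * allWords n w
      ≡⟨ ℤ.*-identityˡ (allWords n w) ⟩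
    allWords n w ∎
    where open ≡-Reasoning

  lowerStar : Fin n → Series n
  lowerStar a = star (interval 1 (val a ∸ 1))

  ∂-zL : ∀ a c → ∂ c (zL a) ≈ 𝟙 (does (val a ≤? val c)) · lowerStar a
  ∂-zL a c w = begin
    ∂ c (zL a) w
      ≡⟨ ∂-⊙-proper (interval (val a) n) (lowerStar a) εS c (𝟙 (inInterval (val a) n c)) refl
                    (∂-interval (val a) n c) w ⟩
    𝟙 (inInterval (val a) n c) * (εS ⊙ lowerStar a) w
      ≡⟨ cong₂ (λ t s → 𝟙 t * s) c≤n (⊙-identityˡ (lowerStar a) w) ⟩
    𝟙 (does (val a ≤? val c)) * lowerStar a w ∎
    where
    open ≡-Reasoning
    c≤n : inInterval (val a) n c ≡ does (val a ≤? val c)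
    c≤n = trans (cong (does (val a ≤? val c) ∧_) (dec-true (val c ≤? n) (toℕ<n c))) (∧-identityʳ _)

  ∂-lowerStar : ∀ a c → ∂ c (lowerStar a) ≈ (1ℤ - 𝟙 (does (val a ≤? val c))) · lowerStar a
  ∂-lowerStar a c w = begin
    lowerStar a (c ∷ w)                                ≡⟨ ∂-star-interval 1 (val a ∸ 1) c w ⟩
    𝟙 (does (val c ≤? val a ∸ 1)) * lowerStar a w      ≡⟨ cong (λ t → 𝟙 t * lowerStar a w) c<a ⟩
    𝟙 (not (does (val a ≤? val c))) * lowerStar a w    ≡⟨ cong (_* lowerStar a w) (𝟙-not (does (val a ≤? val c))) ⟩
    (1ℤ - 𝟙 (does (val a ≤? val c))) * lowerStar a w   ∎
    where
    open ≡-Reasoning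
    c<a : does (val c ≤? val a ∸ 1) ≡ not (does (val a ≤? val c))
    c<a = ≤?-∸1≡not-≤? (val a) (val c) (s≤s z≤n)

  z-∷-∷ : ∀ a v c y → z (a ∷ v) (c ∷ y) ≡ 𝟙 (does (val a ≤? val c)) * (lowerStar a ⊙ z v) y
  z-∷-∷ a v c = ∂-⊙-proper (zL a) (z v) (lowerStar a) c (𝟙 (does (val a ≤? val c))) refl (∂-zL a c)

  lowerStar⊙z-∷ : ∀ a v c y →
    (lowerStar a ⊙ z v) (c ∷ y)
      ≡ z v (c ∷ y) + (1ℤ - 𝟙 (does (val a ≤? val c))) * (lowerStar a ⊙ z v) y
  lowerStar⊙z-∷ a v c y = cong₂ _+_ (ℤ.*-identityˡ (z v (c ∷ y)))
    (trans (⊙-congˡ (z v) (∂-lowerStar a c) y)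
           (⊙-·ˡ (1ℤ - 𝟙 (does (val a ≤? val c))) (lowerStar a) (z v) y))

  lowerStar⊙z : ∀ a v → (∀ c y → z v (c ∷ y) ≡ Z v (c ∷ y) - Z v y) →
    ∀ y → (lowerStar a ⊙ z v) y ≡ Z v y - Z (a ∷ v) y
  lowerStar⊙z a v z-∷ []      =
    trans (ℤ.*-identityˡ (z v [])) (trans (z-[] v) (sym (ℤ.+-identityʳ (Z v []))))
  lowerStar⊙z a v z-∷ (c ∷ y) = begin
    (lowerStar a ⊙ z v) (c ∷ y)
      ≡⟨ lowerStar⊙z-∷ a v c y ⟩
    z v (c ∷ y) + (1ℤ - i) * (lowerStar a ⊙ z v) y
      ≡⟨ cong₂ (λ s t → s + (1ℤ - i) * t) (z-∷ c y) (lowerStar⊙z a v z-∷ y) ⟩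
    (Z v (c ∷ y) - Z v y) + (1ℤ - i) * (Z v y - Z (a ∷ v) y)
      ≡⟨ regroup (Z v (c ∷ y)) (Z v y) (Z (a ∷ v) y) i ⟩
    Z v (c ∷ y) - (Z (a ∷ v) y + i * (Z v y - Z (a ∷ v) y))
      ≡⟨ cong (λ t → Z v (c ∷ y) - t) (Z-∷-∷ a v c y) ⟨
    Z v (c ∷ y) - Z (a ∷ v) (c ∷ y) ∎
    where
    open ≡-Reasoning
    i = 𝟙 (does (val a ≤? val c))
    regroup : ∀ s t r i → (s - t) + (1ℤ - i) * (t - r) ≡ s - (r + i * (t - r))
    regroup = solve-∀

  z-∷ : ∀ u c y → z u (c ∷ y) ≡ Z u (c ∷ y) - Z u y
  z-∷ []      c y = refl
  z-∷ (a ∷ v) c y = begin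
    z (a ∷ v) (c ∷ y)
      ≡⟨ z-∷-∷ a v c y ⟩
    i * (lowerStar a ⊙ z v) y
      ≡⟨ cong (i *_) (lowerStar⊙z a v (z-∷ v) y) ⟩
    i * (Z v y - Z (a ∷ v) y)
      ≡⟨ regroup (Z (a ∷ v) y) i (Z v y - Z (a ∷ v) y) ⟩
    (Z (a ∷ v) y + i * (Z v y - Z (a ∷ v) y)) - Z (a ∷ v) y
      ≡⟨ cong (λ t → t - Z (a ∷ v) y) (Z-∷-∷ a v c y) ⟨
    Z (a ∷ v) (c ∷ y) - Z (a ∷ v) y ∎
    where
    open ≡-Reasoning
    i = 𝟙 (does (val a ≤? val c))
    regroup : ∀ r i d → i * d ≡ (r + i * d) - r
    regroup = solve-∀

  Z≈allWords⊙z : ∀ u → Z u ≈ allWords n ⊙ z u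
  Z≈allWords⊙z u []      = trans (sym (z-[] u)) (sym (ℤ.*-identityˡ (z u [])))
  Z≈allWords⊙z u (c ∷ y) = sym (begin
    1ℤ * z u (c ∷ y) + (∂ c (allWords n) ⊙ z u) y
      ≡⟨ cong₂ _+_ (ℤ.*-identityˡ (z u (c ∷ y))) (⊙-congˡ (z u) (∂-allWords c) y) ⟩
    z u (c ∷ y) + (allWords n ⊙ z u) y
      ≡⟨ cong₂ _+_ (z-∷ u c y) (sym (Z≈allWords⊙z u y)) ⟩
    (Z u (c ∷ y) - Z u y) + Z u y
      ≡⟨ cancel (Z u (c ∷ y)) (Z u y) ⟩
    Z u (c ∷ y) ∎)
    where
    open ≡-Reasoning
    cancel : ∀ s t → (s - t) + t ≡ s
    cancel = solve-∀

suc-==-pred : ∀ k B → (suc (suc k) == B) ≡ (suc k == (B ∸ 1))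
suc-==-pred k zero    = refl
suc-==-pred k (suc B) = refl

≤?∧≥?≡== : ∀ k B → (does (k ≤? B) ∧ does (B ≤? k)) ≡ (k == B)
≤?∧≥?≡== k B = decide (k ≤? B) (B ≤? k) (k ℕ.≟ B)
  where
  decide : (k≤?B : Dec (k ≤ B)) (B≤?k : Dec (B ≤ k)) (k≟B : Dec (k ≡ B)) →
    (does k≤?B ∧ does B≤?k) ≡ does k≟B
  decide (yes k≤B) (yes B≤k) (no k≢B)   = ⊥-elim (k≢B (ℕ.≤-antisym k≤B B≤k))
  decide (yes _)   (yes _)   (yes _)    = refl
  decide (yes _)   (no B≰k)  (yes refl) = ⊥-elim (B≰k ℕ.≤-refl)
  decide (yes _)   (no _)    (no _)     = refl
  decide (no k≰B)  _         (yes refl) = ⊥-elim (k≰B ℕ.≤-refl)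
  decide (no _)    _         (no _)     = refl

-- A position of w with letter B, preceded in w by the letter p (nothing at the
-- start of w), contributes gapWeight p B if it is a gap: −1 if it starts a run of
-- 1s (a gap there is a defect), 1 if it lies inside a run of letters B ≥ 2, 0 if
-- condition (2) forbids the gap.  If it carries the letter A it contributes
-- letterWeight A B: 1 if A = B, −1 if A = B − 1 (a defect), 0 otherwise.
gapWeight : Maybe ℕ → ℕ → ℤ
gapWeight p B = 𝟙 (sameAs p B) - 𝟙 (1 == B)
  where
  sameAs : Maybe ℕ → ℕ → Bool
  sameAs nothing  _ = false
  sameAs (just q) B = q == B

letterWeight : ℕ → ℕ → ℤ
letterWeight A B = 𝟙 (A == B) - 𝟙 (A == (B ∸ 1))

letterWeight-vanish : ∀ a B → B ≤ a → letterWeight (suc a) B ≡ 0ℤ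
letterWeight-vanish a B B≤a = cong₂ (λ s t → 𝟙 s - 𝟙 t)
  (dec-false (suc a ℕ.≟ B) (λ eq → ℕ.1+n≰n (ℕ.≤-trans (ℕ.≤-reflexive eq) B≤a)))
  (dec-false (suc a ℕ.≟ B ∸ 1)
    (λ eq → ℕ.1+n≰n (ℕ.≤-trans (ℕ.≤-reflexive eq) (ℕ.≤-trans (ℕ.m∸n≤m B 1) B≤a))))

module _ {n : ℕ} where

  D : Series n
  D = εS ⊖ lit 1

  gaps : Maybe ℕ → Series n
  gaps nothing  = D
  gaps (just B) = star (lit B) ⊙ D

  ∂-lit : ∀ k b → ∂ b (lit {n} k) ≈ 𝟙 (k == val b) · εS
  ∂-lit k b w = trans (∂-interval k k b w) (cong (λ t → 𝟙 t * εS w) (≤?∧≥?≡== k (val b)))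

  ∂-star-lit : ∀ k b → ∂ b (star (lit {n} k)) ≈ 𝟙 (k == val b) · star (lit k)
  ∂-star-lit k b = ∂-star-· (lit k) refl b (𝟙 (k == val b)) (∂-lit k b)

  ∂-plus-lit⊙ : ∀ k b (g : Series n) →
    ∂ b (plus (lit k) ⊙ g) ≈ 𝟙 (k == val b) · (star (lit k) ⊙ g)
  ∂-plus-lit⊙ k b g = ∂-⊙-proper (plus (lit k)) g (star (lit k)) b (𝟙 (k == val b)) refl
    (λ w → trans (ℤ.+-identityʳ (star (lit k) (b ∷ w))) (∂-star-lit k b w))

  ∂-D : ∀ b → ∂ b D ≈ (- 𝟙 (1 == val b)) · εS
  ∂-D b w = trans (cong (λ t → 0ℤ - t) (∂-lit 1 b w)) (negate (𝟙 (1 == val b)) (εS w))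
    where
    negate : ∀ x y → 0ℤ - x * y ≡ (- x) * y
    negate = solve-∀

  -- 1*(ε − 1) = ε: after a 1 no gap is allowed, so gaps (just 1) = ε.
  star-lit1⊙D : star (lit 1) ⊙ D ≈ εS
  star-lit1⊙D []      = refl
  star-lit1⊙D (b ∷ w) = begin
    1ℤ * D (b ∷ w) + (∂ b (star (lit 1)) ⊙ D) w
      ≡⟨ cong₂ _+_ (cong (1ℤ *_) (∂-D b w))
                   (trans (⊙-congˡ D (∂-star-lit 1 b) w) (⊙-·ˡ i (star (lit 1)) D w)) ⟩
    1ℤ * ((- i) * εS w) + i * (star (lit 1) ⊙ D) w
      ≡⟨ cong (λ t → 1ℤ * ((- i) * εS w) + i * t) (star-lit1⊙D w) ⟩
    1ℤ * ((- i) * εS w) + i * εS w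
      ≡⟨ cancel i (εS w) ⟩
    0ℤ ∎
    where
    open ≡-Reasoning
    i = 𝟙 (1 == val b)
    cancel : ∀ i e → 1ℤ * ((- i) * e) + i * e ≡ 0ℤ
    cancel = solve-∀

  gaps-subst : ∀ k B w → 𝟙 (k == B) * gaps (just k) w ≡ 𝟙 (k == B) * gaps (just B) w
  gaps-subst k B w = 𝟙-==-subst k B (λ j → gaps (just j) w)

  ∂-D-gaps : ∀ b w → D (b ∷ w) ≡ - (𝟙 (1 == val b) * gaps (just (val b)) w)
  ∂-D-gaps b w = begin
    D (b ∷ w)                     ≡⟨ ∂-D b w ⟩
    (- i) * εS w                  ≡⟨ ℤ.neg-distribˡ-* i (εS w) ⟨
    - (i * εS w)                  ≡⟨ cong (λ t → - (i * t)) (star-lit1⊙D w) ⟨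
    - (i * gaps (just 1) w)       ≡⟨ cong -_ (gaps-subst 1 (val b) w) ⟩
    - (i * gaps (just (val b)) w) ∎
    where
    open ≡-Reasoning
    i = 𝟙 (1 == val b)

  ∂-gaps : ∀ p b → ∂ b (gaps p) ≈ gapWeight p (val b) · gaps (just (val b))
  ∂-gaps nothing b w = trans (∂-D-gaps b w) (negate (𝟙 (1 == val b)) (gaps (just (val b)) w))
    where
    negate : ∀ i g → - (i * g) ≡ (0ℤ - i) * g
    negate = solve-∀
  ∂-gaps (just k) b w = begin
    1ℤ * D (b ∷ w) + (∂ b (star (lit k)) ⊙ D) w
      ≡⟨ cong₂ _+_ (cong (1ℤ *_) (∂-D-gaps b w))
                   (trans (⊙-congˡ D (∂-star-lit k b) w) (⊙-·ˡ j (star (lit k)) D w)) ⟩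
    1ℤ * (- (i * G)) + j * gaps (just k) w  ≡⟨ cong (λ t → 1ℤ * (- (i * G)) + t) (gaps-subst k (val b) w) ⟩
    1ℤ * (- (i * G)) + j * G                ≡⟨ collect i j G ⟩
    (j - i) * G                             ∎
    where
    open ≡-Reasoning
    i = 𝟙 (1 == val b)
    j = 𝟙 (k == val b)
    G = gaps (just (val b)) w
    collect : ∀ i j g → 1ℤ * (- (i * g)) + j * g ≡ (j - i) * g
    collect = solve-∀

  letterWeight-gaps : ∀ k B w →
    𝟙 (suc k == B) * gaps (just (suc k)) w - 𝟙 (suc (suc k) == B) * gaps (just (suc (suc k))) w
      ≡ letterWeight (suc k) B * gaps (just B) w
  letterWeight-gaps k B w = begin
    𝟙 (suc k == B) * gaps (just (suc k)) w - 𝟙 (suc (suc k) == B) * gaps (just (suc (suc k))) w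
      ≡⟨ cong₂ _-_ (gaps-subst (suc k) B w) (gaps-subst (suc (suc k)) B w) ⟩
    𝟙 (suc k == B) * G - 𝟙 (suc (suc k) == B) * G
      ≡⟨ cong (λ t → 𝟙 (suc k == B) * G - 𝟙 t * G) (suc-==-pred k B) ⟩
    𝟙 (suc k == B) * G - 𝟙 (suc k == (B ∸ 1)) * G
      ≡⟨ collect (𝟙 (suc k == B)) (𝟙 (suc k == (B ∸ 1))) G ⟩
    letterWeight (suc k) B * G ∎
    where
    open ≡-Reasoning
    G = gaps (just B) w
    collect : ∀ x y g → x * g - y * g ≡ (x - y) * g
    collect = solve-∀

  ∂-mL : ∀ a b → ∂ b (mL a) ≈ letterWeight (val a) (val b) · gaps (just (val b))
  ∂-mL Fin.zero b w = begin
    lit 1 (b ∷ w) - (plus (lit 2) ⊙ D) (b ∷ w)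
      ≡⟨ cong₂ _-_ (∂-lit 1 b w) (∂-plus-lit⊙ 2 b D w) ⟩
    𝟙 (1 == val b) * εS w - 𝟙 (2 == val b) * gaps (just 2) w
      ≡⟨ cong (λ t → 𝟙 (1 == val b) * t - 𝟙 (2 == val b) * gaps (just 2) w) (star-lit1⊙D w) ⟨
    𝟙 (1 == val b) * gaps (just 1) w - 𝟙 (2 == val b) * gaps (just 2) w
      ≡⟨ letterWeight-gaps 0 (val b) w ⟩
    letterWeight 1 (val b) * gaps (just (val b)) w ∎
    where open ≡-Reasoning
  ∂-mL (Fin.suc a) b w = begin
    ((plus (lit k) ⊖ plus (lit (suc k))) ⊙ D) (b ∷ w)
      ≡⟨ ⊙-distribʳ-⊖ (plus (lit k)) (plus (lit (suc k))) D (b ∷ w) ⟩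
    (plus (lit k) ⊙ D) (b ∷ w) - (plus (lit (suc k)) ⊙ D) (b ∷ w)
      ≡⟨ cong₂ _-_ (∂-plus-lit⊙ k b D w) (∂-plus-lit⊙ (suc k) b D w) ⟩
    𝟙 (k == val b) * gaps (just k) w - 𝟙 (suc k == val b) * gaps (just (suc k)) w
      ≡⟨ letterWeight-gaps (suc (toℕ a)) (val b) w ⟩
    letterWeight k (val b) * gaps (just (val b)) w ∎
    where
    open ≡-Reasoning
    k = val (Fin.suc a)

  gaps-[] : ∀ p → gaps p [] ≡ 1ℤ
  gaps-[] nothing  = refl
  gaps-[] (just _) = refl

  mL-[] : ∀ (a : Fin n) → mL a [] ≡ 0ℤ
  mL-[] Fin.zero    = refl
  mL-[] (Fin.suc _) = refl

  m-∷-∷ : ∀ a u b w → m (a ∷ u) (b ∷ w) ≡ letterWeight (val a) (val b) * (gaps (just (val b)) ⊙ m u) w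
  m-∷-∷ a u b =
    ∂-⊙-proper (mL a) (m u) (gaps (just (val b))) b (letterWeight (val a) (val b)) (mL-[] a) (∂-mL a b)

  gaps⊙m-∷ : ∀ p u b w →
    (gaps p ⊙ m u) (b ∷ w) ≡ gapWeight p (val b) * (gaps (just (val b)) ⊙ m u) w + m u (b ∷ w)
  gaps⊙m-∷ p u b w = begin
    gaps p [] * m u (b ∷ w) + (∂ b (gaps p) ⊙ m u) w
      ≡⟨ cong₂ _+_ (trans (cong (_* m u (b ∷ w)) (gaps-[] p)) (ℤ.*-identityˡ (m u (b ∷ w))))
                   (trans (⊙-congˡ (m u) (∂-gaps p b) w) (⊙-·ˡ gw (gaps (just (val b))) (m u) w)) ⟩
    m u (b ∷ w) + gw * (gaps (just (val b)) ⊙ m u) w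
      ≡⟨ ℤ.+-comm (m u (b ∷ w)) _ ⟩
    gw * (gaps (just (val b)) ⊙ m u) w + m u (b ∷ w) ∎
    where
    open ≡-Reasoning
    gw = gapWeight p (val b)

sign : ℕ → ℤ
sign k = -1ℤ ^ k

sign-+ : ∀ k l → sign (k ℕ.+ l) ≡ sign k * sign l
sign-+ = ℤ.^-distribˡ-+-* -1ℤ

embeddingTerm : Maybe ℕ → List ℕ → List ℕ → List ℕ → ℤ
embeddingTerm p u w η = 𝟙 (isExpansion u η) * 𝟙 (cond1 w η) * 𝟙 (cond2 p w η) * sign (defect w η)

-- The signed number of normal embeddings of u into w, where condition (2) is
-- checked as if w were preceded by the letter p.
signedCount : Maybe ℕ → List ℕ → List ℕ → ℤ
signedCount p u w = sumℤ (map (embeddingTerm p u w) (bounded w))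

sumℤ-bounded-∷ : ∀ (h : List ℕ → ℤ) B w →
  sumℤ (map h (bounded (B ∷ w))) ≡ Σ< (suc B) (λ x → sumℤ (map (λ η → h (x ∷ η)) (bounded w)))
sumℤ-bounded-∷ h B w = begin
  sumℤ (map h (concatMap (λ x → map (x ∷_) (bounded w)) (upTo (suc B))))
    ≡⟨ sumℤ-map-concatMap h (λ x → map (x ∷_) (bounded w)) (upTo (suc B)) ⟩
  sumℤ (map (λ x → sumℤ (map h (map (x ∷_) (bounded w)))) (upTo (suc B)))
    ≡⟨ sumℤ-map-applyUpTo (λ x → sumℤ (map h (map (x ∷_) (bounded w)))) (λ x → x) (suc B) ⟩
  Σ< (suc B) (λ x → sumℤ (map h (map (x ∷_) (bounded w))))
    ≡⟨ Σ<-cong (suc B) (λ x → cong sumℤ (map-∘ {g = h} {f = x ∷_} (bounded w))) ⟨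
  Σ< (suc B) (λ x → sumℤ (map (λ η → h (x ∷ η)) (bounded w))) ∎
  where open ≡-Reasoning

cond1-gap : ∀ B w η → cond1 (B ∷ w) (0 ∷ η) ≡ cond1 w η
cond1-gap B w η = cong (_∧ cond1 w η)
  (trans (cong ((0 == B) ∨_) (∨-zeroʳ (0 == (B ∸ 1)))) (∨-zeroʳ (0 == B)))

cond2-letter : ∀ p B w x η → cond2 p (B ∷ w) (suc x ∷ η) ≡ cond2 (just B) w η
cond2-letter nothing  B w x η = cong (_∧ cond2 (just B) w η) (if-eta (B == 1))
cond2-letter (just q) B w x η = cong (_∧ cond2 (just B) w η)
  (trans (if-cong₂ (B == 1) (if-eta (q == B)) (if-eta (q == B))) (if-eta (B == 1)))

cond2-gapWeight : ∀ p B w η → 1 ≤ B →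
  𝟙 (cond2 p (B ∷ w) (0 ∷ η)) * sign (if 0 == (B ∸ 1) then 1 else 0)
    ≡ gapWeight p B * 𝟙 (cond2 (just B) w η)
cond2-gapWeight nothing  (suc zero)    w η _ = ℤ.*-comm (𝟙 (cond2 (just 1) w η)) -1ℤ
cond2-gapWeight nothing  (suc (suc B)) w η _ = refl
cond2-gapWeight (just q) (suc zero)    w η _ = run-of-1s (q == 1) (cond2 (just 1) w η)
  where
  run-of-1s : ∀ s c → 𝟙 ((if s then false else true) ∧ c) * -1ℤ ≡ (𝟙 s - 1ℤ) * 𝟙 c
  run-of-1s true  _     = refl
  run-of-1s false true  = refl
  run-of-1s false false = refl
cond2-gapWeight (just q) (suc (suc B)) w η _ = run-of-B (q == suc (suc B)) (cond2 (just (suc (suc B))) w η)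
  where
  run-of-B : ∀ s c → 𝟙 ((if s then true else false) ∧ c) * 1ℤ ≡ (𝟙 s - 0ℤ) * 𝟙 c
  run-of-B true  true  = refl
  run-of-B true  false = refl
  run-of-B false _     = refl

cond1-letterWeight : ∀ x B →
  𝟙 ((suc x == B) ∨ (suc x == (B ∸ 1)) ∨ (suc x == 0)) * sign (if suc x == (B ∸ 1) then 1 else 0)
    ≡ letterWeight (suc x) B
cond1-letterWeight x B = decide (suc x ℕ.≟ B) (suc x ℕ.≟ B ∸ 1)
  where
  decide : (d : Dec (suc x ≡ B)) (d′ : Dec (suc x ≡ B ∸ 1)) →
    𝟙 (does d ∨ does d′ ∨ false) * sign (if does d′ then 1 else 0) ≡ 𝟙 (does d) - 𝟙 (does d′)
  decide (yes refl) (yes x+1≡x) = ⊥-elim (ℕ.1+n≢n x+1≡x)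
  decide (yes _)    (no _)      = refl
  decide (no _)     (yes _)     = refl
  decide (no _)     (no _)      = refl

embeddingTerm-gap : ∀ p u B w η → 1 ≤ B →
  embeddingTerm p u (B ∷ w) (0 ∷ η) ≡ gapWeight p B * embeddingTerm (just B) u w η
embeddingTerm-gap p u B w η 1≤B = begin
  X * 𝟙 (cond1 (B ∷ w) (0 ∷ η)) * C′ * sign (e ℕ.+ d)
    ≡⟨ cong₂ (λ s t → X * 𝟙 s * C′ * t) (cond1-gap B w η) (sign-+ e d) ⟩
  X * Y * C′ * (sign e * sign d)        ≡⟨ regroup X Y C′ (sign e) (sign d) ⟩
  X * Y * (C′ * sign e) * sign d        ≡⟨ cong (λ t → X * Y * t * sign d) (cond2-gapWeight p B w η 1≤B) ⟩
  X * Y * (gapWeight p B * C) * sign d  ≡⟨ regroup′ X Y (gapWeight p B) C (sign d) ⟩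
  gapWeight p B * (X * Y * C * sign d)  ∎
  where
  open ≡-Reasoning
  X = 𝟙 (isExpansion u η)
  Y = 𝟙 (cond1 w η)
  C = 𝟙 (cond2 (just B) w η)
  C′ = 𝟙 (cond2 p (B ∷ w) (0 ∷ η))
  e = if 0 == (B ∸ 1) then 1 else 0
  d = defect w η
  regroup : ∀ x y c s t → x * y * c * (s * t) ≡ x * y * (c * s) * t
  regroup = solve-∀
  regroup′ : ∀ x y g c t → x * y * (g * c) * t ≡ g * (x * y * c * t)
  regroup′ = solve-∀

embeddingTerm-letter : ∀ p A U B w x η →
  embeddingTerm p (A ∷ U) (B ∷ w) (suc x ∷ η)
    ≡ 𝟙 (suc x == A) * letterWeight (suc x) B * embeddingTerm (just B) U w η
embeddingTerm-letter p A U B w x η = begin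
  𝟙 (a ∧ isExpansion U η) * 𝟙 (c₁ ∧ cond1 w η) * 𝟙 (cond2 p (B ∷ w) (suc x ∷ η)) * sign (e ℕ.+ d)
    ≡⟨ cong₂ _*_ (cong₂ _*_ (cong₂ _*_ (𝟙-∧ a (isExpansion U η)) (𝟙-∧ c₁ (cond1 w η)))
                            (cong 𝟙 (cond2-letter p B w x η)))
                 (sign-+ e d) ⟩
  𝟙 a * X * (𝟙 c₁ * Y) * C * (sign e * sign d)
    ≡⟨ regroup (𝟙 a) X (𝟙 c₁) Y C (sign e) (sign d) ⟩
  𝟙 a * (𝟙 c₁ * sign e) * (X * Y * C * sign d)
    ≡⟨ cong (λ t → 𝟙 a * t * (X * Y * C * sign d)) (cond1-letterWeight x B) ⟩
  𝟙 a * letterWeight (suc x) B * (X * Y * C * sign d) ∎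
  where
  open ≡-Reasoning
  a = suc x == A
  c₁ = (suc x == B) ∨ (suc x == (B ∸ 1)) ∨ (suc x == 0)
  X = 𝟙 (isExpansion U η)
  Y = 𝟙 (cond1 w η)
  C = 𝟙 (cond2 (just B) w η)
  e = if suc x == (B ∸ 1) then 1 else 0
  d = defect w η
  regroup : ∀ a x c y k s t → a * x * (c * y) * k * (s * t) ≡ a * (c * s) * (x * y * k * t)
  regroup = solve-∀

letterSum : Maybe ℕ → List ℕ → ℕ → List ℕ → ℤ
letterSum p u B w = Σ< B (λ x → sumℤ (map (λ η → embeddingTerm p u (B ∷ w) (suc x ∷ η)) (bounded w)))

signedCount-∷ : ∀ p u B w → 1 ≤ B →
  signedCount p u (B ∷ w) ≡ gapWeight p B * signedCount (just B) u w + letterSum p u B w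
signedCount-∷ p u B w 1≤B = trans (sumℤ-bounded-∷ (embeddingTerm p u (B ∷ w)) B w)
  (cong (_+ letterSum p u B w)
    (trans (sumℤ-map-cong (λ η → embeddingTerm-gap p u B w η 1≤B) (bounded w))
           (sumℤ-map-*ˡ (gapWeight p B) (embeddingTerm (just B) u w) (bounded w))))

letterSum-[] : ∀ p B w → letterSum p [] B w ≡ 0ℤ
letterSum-[] p B w = Σ<-vanish B (λ _ → sumℤ-map-vanish (λ _ → refl) (bounded w))

letterSum-∷ : ∀ p a U B w → letterSum p (suc a ∷ U) B w ≡ letterWeight (suc a) B * signedCount (just B) U w
letterSum-∷ p a U B w = begin
  letterSum p (suc a ∷ U) B w                             ≡⟨ Σ<-cong B first-letter-at ⟩
  Σ< B (λ x → 𝟙 (x == a) * (letterWeight (suc x) B * T))  ≡⟨ Σ<-pick B a (λ x → letterWeight (suc x) B * T) vanish ⟩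
  letterWeight (suc a) B * T                              ∎
  where
  open ≡-Reasoning
  T = signedCount (just B) U w
  first-letter-at : ∀ x → sumℤ (map (λ η → embeddingTerm p (suc a ∷ U) (B ∷ w) (suc x ∷ η)) (bounded w))
                          ≡ 𝟙 (x == a) * (letterWeight (suc x) B * T)
  first-letter-at x = trans (sumℤ-map-cong (embeddingTerm-letter p (suc a) U B w x) (bounded w))
    (trans (sumℤ-map-*ˡ (𝟙 (x == a) * letterWeight (suc x) B) (embeddingTerm (just B) U w) (bounded w))
           (ℤ.*-assoc (𝟙 (x == a)) (letterWeight (suc x) B) T))
  vanish : B ≤ a → letterWeight (suc a) B * T ≡ 0ℤ
  vanish B≤a = cong (_* T) (letterWeight-vanish a B B≤a)

module _ {n : ℕ} where

  signedCount≡gaps⊙m : ∀ p (u : Word n) w → signedCount p (map val u) (map val w) ≡ (gaps p ⊙ m u) w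
  signedCount≡gaps⊙m p []      []      = sym (cong (_* 1ℤ) (gaps-[] p))
  signedCount≡gaps⊙m p (a ∷ u) []      =
    sym (trans (cong (λ t → gaps p [] * (t * m u [])) (mL-[] a)) (ℤ.*-zeroʳ (gaps p [])))
  signedCount≡gaps⊙m p u       (b ∷ w) = begin
    signedCount p (map val u) (val b ∷ map val w)
      ≡⟨ signedCount-∷ p (map val u) (val b) (map val w) (s≤s z≤n) ⟩
    gw * signedCount (just (val b)) (map val u) (map val w) + letterSum p (map val u) (val b) (map val w)
      ≡⟨ cong₂ _+_ (cong (gw *_) (signedCount≡gaps⊙m (just (val b)) u w)) (letterSum≡m u) ⟩
    gw * (gaps (just (val b)) ⊙ m u) w + m u (b ∷ w)
      ≡⟨ gaps⊙m-∷ p u b w ⟨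
    (gaps p ⊙ m u) (b ∷ w) ∎
    where
    open ≡-Reasoning
    gw = gapWeight p (val b)
    letterSum≡m : ∀ u → letterSum p (map val u) (val b) (map val w) ≡ m u (b ∷ w)
    letterSum≡m []      = letterSum-[] p (val b) (map val w)
    letterSum≡m (a ∷ u) = begin
      letterSum p (val a ∷ map val u) (val b) (map val w)
        ≡⟨ letterSum-∷ p (toℕ a) (map val u) (val b) (map val w) ⟩
      letterWeight (val a) (val b) * signedCount (just (val b)) (map val u) (map val w)
        ≡⟨ cong (letterWeight (val a) (val b) *_) (signedCount≡gaps⊙m (just (val b)) u w) ⟩
      letterWeight (val a) (val b) * (gaps (just (val b)) ⊙ m u) w
        ≡⟨ m-∷-∷ a u b w ⟨
      m (a ∷ u) (b ∷ w) ∎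

  signedCount-vanish : ∀ p (u w : Word n) → ¬ (u ≼ w) → signedCount p (map val u) (map val w) ≡ 0ℤ
  signedCount-vanish p []      w       u⋠w = ⊥-elim (u⋠w done)
  signedCount-vanish p (a ∷ u) []      _   = refl
  signedCount-vanish p (a ∷ u) (b ∷ w) u⋠w = begin
    signedCount p (val a ∷ map val u) (val b ∷ map val w)
      ≡⟨ signedCount-∷ p (val a ∷ map val u) (val b) (map val w) (s≤s z≤n) ⟩
    gw * signedCount (just (val b)) (val a ∷ map val u) (map val w)
      + letterSum p (val a ∷ map val u) (val b) (map val w)
      ≡⟨ cong₂ _+_ (cong (gw *_) (signedCount-vanish (just (val b)) (a ∷ u) w (u⋠w ∘ skip)))
                   (letterSum-∷ p (toℕ a) (map val u) (val b) (map val w)) ⟩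
    gw * 0ℤ + letterWeight (val a) (val b) * T
      ≡⟨ cong₂ _+_ (ℤ.*-zeroʳ gw) (no-first-letter (val a ≤? val b)) ⟩
    0ℤ ∎
    where
    open ≡-Reasoning
    gw = gapWeight p (val b)
    T = signedCount (just (val b)) (map val u) (map val w)
    no-first-letter : Dec (val a ≤ val b) → letterWeight (val a) (val b) * T ≡ 0ℤ
    no-first-letter (yes a≤b) = trans (cong (letterWeight (val a) (val b) *_)
                                            (signedCount-vanish (just (val b)) u w (u⋠w ∘ take a≤b)))
                                      (ℤ.*-zeroʳ (letterWeight (val a) (val b)))
    no-first-letter (no a≰b)  = cong (_* T) (letterWeight-vanish (toℕ a) (val b) (ℕ.≤-pred (ℕ.≰⇒> a≰b)))

  M≡signedCount : ∀ (u w : Word n) → M u w ≡ signedCount nothing (map val u) (map val w)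
  M≡signedCount u w with u ≼? w
  ... | yes _  = trans (sumℤ-map-filterᵇ (isNormalEmbedding U W) (λ η → sign (defect W η)) (bounded W))
                       (sumℤ-map-cong (λ η → cong (_* sign (defect W η))
                                        (𝟙-∧-∧ (isExpansion U η) (cond1 W η) (cond2 nothing W η)))
                                      (bounded W))
    where
    U = map val u
    W = map val w
  ... | no u⋠w = sym (signedCount-vanish nothing u w u⋠w)

mainTheorem1 : (n : ℕ) → 1 ≤ n → (u : Word n) →
    ((w : Word n) → Z u w ≡ (allWords n ⊙ z u) w)
    × ((w : Word n) → M u w ≡ ((εS ⊖ lit 1) ⊙ m u) w)
mainTheorem1 n _ u = Z≈allWords⊙z u , λ w → trans (M≡signedCount u w) (signedCount≡gaps⊙m nothing u w)
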